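{- For every $N\ge 2$, $A(3,N)\ge \frac{N(N-1)}{4}$.
   Context: Fix integers $N\ge 2$ and $C\ge 1$ (the grooming factor). Let $\vec C_N$ be the directed cycle on vertices $0,1,\dots,N-1$ with arcs $(i,i+1 \bmod N)$. For distinct vertices $u,v$ let $d(u,v)=(v-u)\bmod N$ be the length of the directed path from $u$ to $v$ in $\vec C_N$. A request tournament $T_N$ is a tournament on $\{0,\dots,N-1\}$ containing every arc $(u,v)$ with $d(u,v)<N/2$ and, when $N$ is even, exactly one of the two arcs $(i,i+N/2)$, $(i+N/2,i)$ for each $0\le i<N/2$. Each arc $(u,v)$ of $T_N$ is routed along the directed path from $u$ to $v$ in $\vec C_N$. For a subdigraph $B$ of $T_N$ and an arc $e$ of $\vec C_N$, the load $L(B,e)$ is the number of arcs of $B$ whose route contains $e$; $B$ is admissible if $L(B,e)\le C$ for every arc $e$. A valid partition is a partition of the arc set of $T_N$ into admissible subdigraphs $B_1,\dots,B_W$, where $V(B_\omega)$ is the set of endpoints of arcs of $B_\omega$; its cost is $\sum_\omega |V(B_\omega)|$. $A(C,N)$ denotes the minimum cost of a valid partition over all choices of $T_N$ and all valid partitions. -}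

module Defs where

open import Data.Nat using (ℕ; _+_; _*_; _∸_; _≤_; _<_; _≤ᵇ_; _<ᵇ_)
open import Data.Bool using (Bool; true; false; if_then_else_; _∧_; _∨_; not)
open import Data.Fin using (Fin; toℕ; _≟_)
open import Data.List using (List; map; allFin)
open import Data.Nat.ListAction using (sum)
open import Data.Bool.ListAction using (any)
open import Relation.Nullary.Decidable using (⌊_⌋)
open import Relation.Binary.PropositionalEquality using (_≡_; _≢_)

Σ : ∀ {n} → (Fin n → ℕ) → ℕ
Σ {n} f = sum (map f (allFin n))

count : ∀ {n} → (Fin n → Bool) → ℕ
count f = Σ (λ i → if f i then 1 else 0)

anyFin : ∀ {n} → (Fin n → Bool) → Bool
anyFin {n} f = any f (allFin n)

-- d(u,v) = (v - u) mod N, length of the directed path u → v in the directed cycle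
dist : (N : ℕ) → Fin N → Fin N → ℕ
dist N u v = if toℕ u ≤ᵇ toℕ v then toℕ v ∸ toℕ u else (N + toℕ v) ∸ toℕ u

-- R is a request tournament T_N : a tournament on Fin N (R u v = true iff arc (u,v))
-- containing every arc (u,v) with d(u,v) < N/2, i.e. 2 d(u,v) < N.
-- (For even N, antipodal pairs get exactly one arc by the tournament property.)
record IsRequestTournament (N : ℕ) (R : Fin N → Fin N → Bool) : Set where
  field
    irrefl     : ∀ u → R u u ≡ false
    tournament : ∀ u v → u ≢ v → R v u ≡ not (R u v)
    short      : ∀ u v → u ≢ v → 2 * dist N u v < N → R u v ≡ true

-- A partition of the arcs of R into W subdigraphs B_0..B_{W-1}, given by a
-- colouring col : arc (u,v) of R lies in B_ω iff col u v = ω.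
inB : {N W : ℕ} → (Fin N → Fin N → Bool) → (Fin N → Fin N → Fin W) →
      Fin W → Fin N → Fin N → Bool
inB R col ω u v = R u v ∧ ⌊ col u v ≟ ω ⌋

-- the route of arc (u,v) (directed path u → v in the cycle) contains the
-- cycle arc (i, i+1) iff d(u,i) < d(u,v)
onRoute : (N : ℕ) → Fin N → Fin N → Fin N → Bool
onRoute N u v i = dist N u i <ᵇ dist N u v

load : {N W : ℕ} → (Fin N → Fin N → Bool) → (Fin N → Fin N → Fin W) →
       Fin W → Fin N → ℕ
load {N} R col ω i =
  Σ (λ u → count (λ v → inB R col ω u v ∧ onRoute N u v i))

Admissible : {N W : ℕ} → ℕ → (Fin N → Fin N → Bool) →
             (Fin N → Fin N → Fin W) → Set
Admissible C R col = ∀ ω i → load R col ω i ≤ C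

vertexCount : {N W : ℕ} → (Fin N → Fin N → Bool) → (Fin N → Fin N → Fin W) →
              Fin W → ℕ
vertexCount R col ω =
  count (λ x → anyFin (λ y → inB R col ω x y ∨ inB R col ω y x))

cost : {N W : ℕ} → (Fin N → Fin N → Bool) → (Fin N → Fin N → Fin W) → ℕ
cost R col = Σ (vertexCount R col)

-- "A(C,N) ≥ k" (k given as numerator/denominator: A(C,N) ≥ num/den) :
-- every valid partition of every request tournament has cost ≥ num/den.
ALowerBound : (C N num den : ℕ) → Set
ALowerBound C N num den =
  (R : Fin N → Fin N → Bool) → IsRequestTournament N R →
  (W : ℕ) (col : Fin N → Fin N → Fin W) → Admissible C R col →
  num ≤ den * cost R col

-- Fix a class B of the partition with k vertices and m arcs, and for an arc (u,v) let c(u,v)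
-- count the vertices of B among u, …, v-1, i.e. those whose outgoing cycle arc the route uses.
-- Summing the loads over these cycle arcs double counts: Σ c(u,v) ≤ C k. Every route starts at
-- a vertex of B, so c ≥ 1, and at each vertex u only the shortest out-arc can have c = 1,
-- because every longer out-arc of u passes through the head of the shortest one. Hence
-- 2m - k ≤ C k. Summing 2m ≤ (C+1) k over the classes, the N(N-1)/2 arcs of a tournament
-- give N(N-1) ≤ (C+1) cost.
module Submission where

open import Defs
open import Data.Nat using (ℕ; zero; suc; _+_; _*_; _∸_; _≤_; _<_; _≤ᵇ_; _<ᵇ_; z≤n; s≤s)
open import Data.Nat.Properties hiding (_≟_; suc-injective)
open import Data.Bool using (Bool; true; false; if_then_else_; _∧_; _∨_; not; T)
open import Data.Bool.Properties using (∨-zeroʳ; ∧-conicalˡ; ∧-conicalʳ; T-≡)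
open import Data.Fin using (Fin; toℕ; zero; suc; _≟_)
open import Data.Fin.Properties using (toℕ-injective; toℕ<n; suc-injective)
open import Data.List.Properties using (map-tabulate)
import Data.Nat.ListAction as List
import Data.Bool.ListAction as List
open import Algebra.Properties.Semiring.Sum +-*-semiring using (sum; sum-cong-≗; ∑-distrib-+; ∑-comm; *-distribˡ-sum)
open import Function using (_∘_; id; Equivalence)
open import Relation.Nullary using (yes; no; contradiction)
open import Relation.Nullary.Decidable using (⌊_⌋)
open import Relation.Binary using (tri<; tri≈; tri>)
open import Relation.Binary.PropositionalEquality

indicator : Bool → ℕ
indicator b = if b then 1 else 0

Σ-suc : ∀ {n} (f : Fin (suc n) → ℕ) → Σ f ≡ f zero + Σ (f ∘ suc)
Σ-suc f = cong (λ xs → f zero + List.sum xs)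
  (trans (map-tabulate suc f) (sym (map-tabulate id (f ∘ suc))))

Σ≡sum : ∀ {n} (f : Fin n → ℕ) → Σ f ≡ sum f
Σ≡sum {zero} f = refl
Σ≡sum {suc n} f = trans (Σ-suc f) (cong (f zero +_) (Σ≡sum (f ∘ suc)))

ΣΣ≡sumsum : ∀ {m n} (f : Fin m → Fin n → ℕ) → Σ (λ i → Σ (f i)) ≡ sum (λ i → sum (f i))
ΣΣ≡sumsum f = trans (Σ≡sum (λ i → Σ (f i))) (sum-cong-≗ (λ i → Σ≡sum (f i)))

Σ-cong : ∀ {n} {f g : Fin n → ℕ} → (∀ i → f i ≡ g i) → Σ f ≡ Σ g
Σ-cong {f = f} {g} f≗g rewrite Σ≡sum f | Σ≡sum g = sum-cong-≗ f≗g

Σ-mono : ∀ {n} {f g : Fin n → ℕ} → (∀ i → f i ≤ g i) → Σ f ≤ Σ g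
Σ-mono {zero} f≤g = z≤n
Σ-mono {suc n} {f} {g} f≤g rewrite Σ-suc f | Σ-suc g = +-mono-≤ (f≤g zero) (Σ-mono (f≤g ∘ suc))

Σ-distrib-+ : ∀ {n} (f g : Fin n → ℕ) → Σ (λ i → f i + g i) ≡ Σ f + Σ g
Σ-distrib-+ f g rewrite Σ≡sum (λ i → f i + g i) | Σ≡sum f | Σ≡sum g = ∑-distrib-+ f g

ΣΣ-distrib-+ : ∀ {m n} (f g : Fin m → Fin n → ℕ) →
               Σ (λ i → Σ (λ j → f i j + g i j)) ≡ Σ (λ i → Σ (f i)) + Σ (λ i → Σ (g i))
ΣΣ-distrib-+ f g =
  trans (Σ-cong (λ i → Σ-distrib-+ (f i) (g i))) (Σ-distrib-+ (λ i → Σ (f i)) (λ i → Σ (g i)))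

*-distribˡ-Σ : ∀ {n} c (f : Fin n → ℕ) → c * Σ f ≡ Σ (λ i → c * f i)
*-distribˡ-Σ c f rewrite Σ≡sum f | Σ≡sum (λ i → c * f i) = *-distribˡ-sum c f

Σ-comm : ∀ {m n} (f : Fin m → Fin n → ℕ) → Σ (λ i → Σ (f i)) ≡ Σ (λ j → Σ (λ i → f i j))
Σ-comm f rewrite ΣΣ≡sumsum f | ΣΣ≡sumsum (λ j i → f i j) = ∑-comm f

Σ-const : ∀ {n} c → Σ {n} (λ _ → c) ≡ n * c
Σ-const {zero} c = refl
Σ-const {suc n} c = trans (Σ-suc {n} (λ _ → c)) (cong (c +_) (Σ-const {n} c))

Σ-zero : ∀ {n} → Σ {n} (λ _ → 0) ≡ 0
Σ-zero {n} = trans (Σ-const {n} 0) (*-zeroʳ n)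

count-singleton : ∀ {n} (i : Fin n) → count (λ j → ⌊ i ≟ j ⌋) ≡ 1
count-singleton {suc n} zero = trans (Σ-suc {n} (λ j → indicator ⌊ zero ≟ j ⌋)) (cong suc (Σ-zero {n}))
count-singleton {suc n} (suc i) =
  trans (Σ-suc {n} (λ j → indicator ⌊ suc i ≟ j ⌋)) (trans (Σ-cong {n} shift) (count-singleton i))
  where
  shift : ∀ j → indicator ⌊ suc i ≟ suc j ⌋ ≡ indicator ⌊ i ≟ j ⌋
  shift j with i ≟ j
  ... | yes _ = refl
  ... | no _ = refl

count≤1 : ∀ {n} (f : Fin n → Bool) → (∀ i j → f i ≡ true → f j ≡ true → i ≡ j) → count f ≤ 1
count≤1 {zero} f unique = z≤n
count≤1 {suc n} f unique rewrite Σ-suc (indicator ∘ f) with f zero in f0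
... | true = ≤-reflexive (cong suc (trans (Σ-cong {n} rest-false) (Σ-zero {n})))
  where
  rest-false : ∀ i → indicator (f (suc i)) ≡ 0
  rest-false i with f (suc i) in fi
  ... | true with () ← unique zero (suc i) f0 fi
  ... | false = refl
... | false = count≤1 (f ∘ suc) (λ i j fi fj → suc-injective (unique (suc i) (suc j) fi fj))

0<count : ∀ {n} (f : Fin n → Bool) (i : Fin n) → f i ≡ true → 0 < count f
0<count f i fi = subst (_≤ count f) (count-singleton i) (Σ-mono below)
  where
  below : ∀ j → indicator ⌊ i ≟ j ⌋ ≤ indicator (f j)
  below j with i ≟ j
  ... | yes refl rewrite fi = ≤-refl
  ... | no _ = z≤n

2≤count : ∀ {n} (f : Fin n → Bool) (i j : Fin n) → f i ≡ true → f j ≡ true → i ≢ j → 2 ≤ count f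
2≤count f i j fi fj i≢j = subst (_≤ count f) two (Σ-mono below)
  where
  two : Σ (λ k → indicator ⌊ i ≟ k ⌋ + indicator ⌊ j ≟ k ⌋) ≡ 2
  two = trans (Σ-distrib-+ (λ k → indicator ⌊ i ≟ k ⌋) (λ k → indicator ⌊ j ≟ k ⌋))
     (cong₂ _+_ (count-singleton i) (count-singleton j))
  below : ∀ k → indicator ⌊ i ≟ k ⌋ + indicator ⌊ j ≟ k ⌋ ≤ indicator (f k)
  below k with i ≟ k | j ≟ k
  ... | yes refl | yes refl = contradiction refl i≢j
  ... | yes refl | no _ rewrite fi = ≤-refl
  ... | no _ | yes refl rewrite fj = ≤-refl
  ... | no _ | no _ = z≤n

anyFin-suc : ∀ {n} (f : Fin (suc n) → Bool) → anyFin f ≡ (f zero ∨ anyFin (f ∘ suc))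
anyFin-suc f = cong (λ bs → f zero ∨ List.or bs)
  (trans (map-tabulate suc f) (sym (map-tabulate id (f ∘ suc))))

anyFin-witness : ∀ {n} (f : Fin n → Bool) (i : Fin n) → f i ≡ true → anyFin f ≡ true
anyFin-witness f zero fi rewrite anyFin-suc f | fi = refl
anyFin-witness f (suc i) fi rewrite anyFin-suc f | anyFin-witness (f ∘ suc) i fi = ∨-zeroʳ (f zero)

≤ᵇ≡true⇒≤ : ∀ {m n} → (m ≤ᵇ n) ≡ true → m ≤ n
≤ᵇ≡true⇒≤ {m} {n} m≤ᵇn = ≤ᵇ⇒≤ m n (Equivalence.from T-≡ m≤ᵇn)

toℕ≤N+toℕ : ∀ {N} (u v : Fin N) → toℕ u ≤ N + toℕ v
toℕ≤N+toℕ {N} u v = ≤-trans (<⇒≤ (toℕ<n u)) (m≤m+n N (toℕ v))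

toℕ≢N+toℕ : ∀ {N} (u v : Fin N) → toℕ u ≢ N + toℕ v
toℕ≢N+toℕ {N} u v eq = <⇒≱ (toℕ<n u) (subst (N ≤_) (sym eq) (m≤m+n N (toℕ v)))

dist-self : ∀ {N} (u : Fin N) → dist N u u ≡ 0
dist-self u rewrite Equivalence.to T-≡ (≤⇒≤ᵇ (≤-refl {toℕ u})) = n∸n≡0 (toℕ u)

0<dist : ∀ {N} {u v : Fin N} → u ≢ v → 0 < dist N u v
0<dist {N} {u} {v} u≢v with toℕ u ≤ᵇ toℕ v in u≤v
... | true = m<n⇒0<n∸m (≤∧≢⇒< (≤ᵇ≡true⇒≤ u≤v) (u≢v ∘ toℕ-injective))
... | false = m<n⇒0<n∸m (<-≤-trans (toℕ<n u) (m≤m+n N (toℕ v)))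

dist-injective : ∀ {N} (u : Fin N) {v w : Fin N} → dist N u v ≡ dist N u w → v ≡ w
dist-injective {N} u {v} {w} eq with toℕ u ≤ᵇ toℕ v in u≤v | toℕ u ≤ᵇ toℕ w in u≤w
... | true | true = toℕ-injective (∸-cancelʳ-≡ {o = toℕ u} (≤ᵇ≡true⇒≤ u≤v) (≤ᵇ≡true⇒≤ u≤w) eq)
... | true | false =
  contradiction (∸-cancelʳ-≡ (≤ᵇ≡true⇒≤ u≤v) (toℕ≤N+toℕ u w) eq) (toℕ≢N+toℕ v w)
... | false | true =
  contradiction (sym (∸-cancelʳ-≡ (toℕ≤N+toℕ u v) (≤ᵇ≡true⇒≤ u≤w) eq)) (toℕ≢N+toℕ w v)
... | false | false =
  toℕ-injective (+-cancelˡ-≡ N _ _ (∸-cancelʳ-≡ (toℕ≤N+toℕ u v) (toℕ≤N+toℕ u w) eq))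

onRoute-source : ∀ {N} {u v : Fin N} → u ≢ v → onRoute N u v u ≡ true
onRoute-source {N} {u} {v} u≢v =
  Equivalence.to T-≡ (subst (λ d → T (d <ᵇ dist N u v)) (sym (dist-self u)) (<⇒<ᵇ (0<dist u≢v)))

onRoute-nearer : ∀ {N} {u v w : Fin N} → dist N u v < dist N u w → onRoute N u w v ≡ true
onRoute-nearer lt = Equivalence.to T-≡ (<⇒<ᵇ lt)

indicator-exchange : ∀ a b c → indicator a * indicator (b ∧ c) ≡ indicator b * indicator (a ∧ c)
indicator-exchange true true c = refl
indicator-exchange true false c = refl
indicator-exchange false true c = refl
indicator-exchange false false c = refl

2≤n+[n≤1] : ∀ n → 0 < n → 2 ≤ n + indicator (n ≤ᵇ 1)
2≤n+[n≤1] (suc zero) _ = ≤-refl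
2≤n+[n≤1] (suc (suc n)) _ = s≤s (s≤s z≤n)

arcCount : ∀ {N} → (Fin N → Fin N → Bool) → ℕ
arcCount E = Σ (λ u → count (E u))

isVertex : ∀ {N} → (Fin N → Fin N → Bool) → Fin N → Bool
isVertex E x = anyFin (λ y → E x y ∨ E y x)

routeLoad : ∀ {N} → (Fin N → Fin N → Bool) → Fin N → ℕ
routeLoad {N} E i = Σ (λ u → count (λ v → E u v ∧ onRoute N u v i))

module _ {N : ℕ} (E : Fin N → Fin N → Bool) (E-irrefl : ∀ u → E u u ≡ false) where

  verticesOnRoute : Fin N → Fin N → ℕ
  verticesOnRoute u v = count (λ x → isVertex E x ∧ onRoute N u v x)

  arc⇒≢ : ∀ {u v} → E u v ≡ true → u ≢ v
  arc⇒≢ {u} uv refl with () ← trans (sym (E-irrefl u)) uv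

  source-isVertex : ∀ {u v} → E u v ≡ true → isVertex E u ≡ true
  source-isVertex {u} {v} uv = anyFin-witness (λ y → E u y ∨ E y u) v (cong (_∨ E v u) uv)

  target-isVertex : ∀ {u v} → E u v ≡ true → isVertex E v ≡ true
  target-isVertex {u} {v} uv =
    anyFin-witness (λ y → E v y ∨ E y v) u (trans (cong (E v u ∨_) uv) (∨-zeroʳ (E v u)))

  0<verticesOnRoute : ∀ {u v} → E u v ≡ true → 0 < verticesOnRoute u v
  0<verticesOnRoute {u} uv = 0<count _ u (cong₂ _∧_ (source-isVertex uv) (onRoute-source (arc⇒≢ uv)))

  2≤verticesOnRoute : ∀ {u v w} → E u v ≡ true → E u w ≡ true → dist N u v < dist N u w →
                      2 ≤ verticesOnRoute u w
  2≤verticesOnRoute {u} {v} {w} uv uw nearer = 2≤count _ u v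
    (cong₂ _∧_ (source-isVertex uv) (onRoute-source (arc⇒≢ uw)))
    (cong₂ _∧_ (target-isVertex uv) (onRoute-nearer {u = u} {v} {w} nearer))
    (arc⇒≢ uv)

  shortArcs≤1 : ∀ u → count (λ v → E u v ∧ (verticesOnRoute u v ≤ᵇ 1)) ≤ indicator (isVertex E u)
  shortArcs≤1 u with isVertex E u in u-vertex
  ... | true = count≤1 _ unique
    where
    unique : ∀ v w → (E u v ∧ (verticesOnRoute u v ≤ᵇ 1)) ≡ true →
             (E u w ∧ (verticesOnRoute u w ≤ᵇ 1)) ≡ true → v ≡ w
    unique v w short-v short-w with <-cmp (dist N u v) (dist N u w)
    ... | tri≈ _ eq _ = dist-injective u eq
    ... | tri< lt _ _ = contradiction
      (≤-trans (2≤verticesOnRoute (∧-conicalˡ _ _ short-v) (∧-conicalˡ _ _ short-w) lt)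
               (≤ᵇ≡true⇒≤ (∧-conicalʳ _ _ short-w))) (<-irrefl refl)
    ... | tri> _ _ gt = contradiction
      (≤-trans (2≤verticesOnRoute (∧-conicalˡ _ _ short-w) (∧-conicalˡ _ _ short-v) gt)
               (≤ᵇ≡true⇒≤ (∧-conicalʳ _ _ short-v))) (<-irrefl refl)
  ... | false = ≤-reflexive (trans (Σ-cong {N} no-arc) (Σ-zero {N}))
    where
    no-arc : ∀ v → indicator (E u v ∧ (verticesOnRoute u v ≤ᵇ 1)) ≡ 0
    no-arc v with E u v in uv
    ... | true with () ← trans (sym u-vertex) (source-isVertex uv)
    ... | false = refl

  arc-weight : ∀ u v → 2 * indicator (E u v) ≤
               indicator (E u v) * verticesOnRoute u v + indicator (E u v ∧ (verticesOnRoute u v ≤ᵇ 1))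
  arc-weight u v with E u v in uv
  ... | true rewrite *-identityˡ (verticesOnRoute u v) = 2≤n+[n≤1] _ (0<verticesOnRoute uv)
  ... | false = z≤n

  routeLoad-double-count :
    Σ (λ x → indicator (isVertex E x) * routeLoad E x) ≡
    Σ (λ u → Σ (λ v → indicator (E u v) * verticesOnRoute u v))
  routeLoad-double-count = begin
      Σ (λ x → indicator (V x) * routeLoad E x)
    ≡⟨ Σ-cong {N} (λ x → *-distribˡ-Σ {N} (indicator (V x)) _) ⟩
      Σ (λ x → Σ (λ u → indicator (V x) * count (λ v → E u v ∧ onRoute N u v x)))
    ≡⟨ Σ-cong {N} (λ x → Σ-cong {N} (λ u → *-distribˡ-Σ {N} (indicator (V x)) _)) ⟩
      Σ (λ x → Σ (λ u → Σ (λ v → indicator (V x) * indicator (E u v ∧ onRoute N u v x))))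
    ≡⟨ Σ-cong {N} (λ x → Σ-cong {N} (λ u → Σ-cong {N} (λ v → indicator-exchange (V x) (E u v) _))) ⟩
      Σ (λ x → Σ (λ u → Σ (λ v → indicator (E u v) * indicator (V x ∧ onRoute N u v x))))
    ≡⟨ Σ-comm (λ x u → Σ (λ v → indicator (E u v) * indicator (V x ∧ onRoute N u v x))) ⟩
      Σ (λ u → Σ (λ x → Σ (λ v → indicator (E u v) * indicator (V x ∧ onRoute N u v x))))
    ≡⟨ Σ-cong {N} (λ u → Σ-comm (λ x v → indicator (E u v) * indicator (V x ∧ onRoute N u v x))) ⟩
      Σ (λ u → Σ (λ v → Σ (λ x → indicator (E u v) * indicator (V x ∧ onRoute N u v x))))
    ≡⟨ Σ-cong {N} (λ u → Σ-cong {N} (λ v → sym (*-distribˡ-Σ {N} (indicator (E u v)) _))) ⟩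
      Σ (λ u → Σ (λ v → indicator (E u v) * verticesOnRoute u v))
    ∎
    where
    open ≡-Reasoning
    V = isVertex E

  2*arcCount≤ : ∀ C → (∀ i → routeLoad E i ≤ C) → 2 * arcCount E ≤ suc C * count (isVertex E)
  2*arcCount≤ C load≤C = begin
      2 * arcCount E
    ≡⟨ *-distribˡ-Σ 2 (λ u → count (E u)) ⟩
      Σ (λ u → 2 * count (E u))
    ≡⟨ Σ-cong {N} (λ u → *-distribˡ-Σ 2 (indicator ∘ E u)) ⟩
      Σ (λ u → Σ (λ v → 2 * indicator (E u v)))
    ≤⟨ Σ-mono {N} (λ u → Σ-mono {N} (arc-weight u)) ⟩
      Σ (λ u → Σ (λ v → indicator (E u v) * verticesOnRoute u v + indicator (short u v)))
    ≡⟨ ΣΣ-distrib-+ {N} {N} _ _ ⟩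
      Σ (λ u → Σ (λ v → indicator (E u v) * verticesOnRoute u v)) + Σ (λ u → count (short u))
    ≤⟨ +-mono-≤ (≤-reflexive (sym routeLoad-double-count)) (Σ-mono shortArcs≤1) ⟩
      Σ (λ x → indicator (V x) * routeLoad E x) + count V
    ≤⟨ +-monoˡ-≤ (count V) vertexLoad≤ ⟩
      C * count V + count V
    ≡⟨ +-comm (C * count V) (count V) ⟩
      suc C * count V
    ∎
    where
    open ≤-Reasoning
    V = isVertex E
    short : Fin N → Fin N → Bool
    short u v = E u v ∧ (verticesOnRoute u v ≤ᵇ 1)
    vertexLoad≤ : Σ (λ x → indicator (V x) * routeLoad E x) ≤ C * count V
    vertexLoad≤ = ≤-trans (Σ-mono {N} pointwise) (≤-reflexive (sym (*-distribˡ-Σ C (indicator ∘ V))))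
      where
      pointwise : ∀ x → indicator (V x) * routeLoad E x ≤ C * indicator (V x)
      pointwise x with V x
      ... | true rewrite *-identityˡ (routeLoad E x) | *-identityʳ C = load≤C x
      ... | false = z≤n

module _ {N : ℕ} (R : Fin N → Fin N → Bool) (R-irrefl : ∀ u → R u u ≡ false)
         (R-tournament : ∀ u v → u ≢ v → R v u ≡ not (R u v)) where

  private
    same : Fin N → Fin N → Bool
    same u v = ⌊ u ≟ v ⌋

  pair-contribution : ∀ u v → indicator (R u v) + indicator (R v u) + indicator (same u v) ≡ 1
  pair-contribution u v with u ≟ v
  ... | yes refl rewrite R-irrefl u = refl
  ... | no u≢v rewrite R-tournament u v u≢v with R u v
  ...   | true = refl
  ...   | false = refl

  arcCount-tournament : N * (N ∸ 1) ≡ 2 * arcCount R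
  arcCount-tournament = begin
      N * (N ∸ 1)
    ≡⟨ *-distribˡ-∸ N N 1 ⟩
      N * N ∸ N * 1
    ≡⟨ cong₂ _∸_ (sym twice+N) (*-identityʳ N) ⟩
      arcCount R + arcCount R + N ∸ N
    ≡⟨ m+n∸n≡m (arcCount R + arcCount R) N ⟩
      arcCount R + arcCount R
    ≡⟨ cong (arcCount R +_) (sym (+-identityʳ (arcCount R))) ⟩
      2 * arcCount R
    ∎
    where
    open ≡-Reasoning
    twice+N : arcCount R + arcCount R + N ≡ N * N
    twice+N = begin
        arcCount R + arcCount R + N
      ≡⟨ cong₂ (λ a b → arcCount R + a + b) (Σ-comm (λ u v → indicator (R u v))) diagonal ⟩
        Σ (λ u → count (R u)) + Σ (λ u → Σ (λ v → indicator (R v u))) + Σ (λ u → count (same u))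
      ≡⟨ cong (_+ Σ (λ u → count (same u))) (sym (ΣΣ-distrib-+ {N} {N} _ _)) ⟩
        Σ (λ u → Σ (λ v → indicator (R u v) + indicator (R v u))) + Σ (λ u → count (same u))
      ≡⟨ sym (ΣΣ-distrib-+ {N} {N} _ _) ⟩
        Σ (λ u → Σ (λ v → indicator (R u v) + indicator (R v u) + indicator (same u v)))
      ≡⟨ Σ-cong {N} (λ u → trans (Σ-cong {N} (pair-contribution u)) (Σ-const {N} 1)) ⟩
        Σ {N} (λ _ → N * 1)
      ≡⟨ trans (Σ-const {N} (N * 1)) (cong (N *_) (*-identityʳ N)) ⟩
        N * N
      ∎
      where
      diagonal : N ≡ Σ (λ u → count (same u))
      diagonal = sym (trans (Σ-cong {N} count-singleton) (trans (Σ-const {N} 1) (*-identityʳ N)))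

arcCount-partition : ∀ {N W} (R : Fin N → Fin N → Bool) (col : Fin N → Fin N → Fin W) →
                     Σ (λ ω → arcCount (inB R col ω)) ≡ arcCount R
arcCount-partition {N} {W} R col =
  trans (Σ-comm (λ ω u → count (inB R col ω u)))
        (Σ-cong (λ u → trans (Σ-comm (λ ω v → indicator (inB R col ω u v))) (Σ-cong (one-class u))))
  where
  one-class : ∀ u v → Σ (λ ω → indicator (R u v ∧ ⌊ col u v ≟ ω ⌋)) ≡ indicator (R u v)
  one-class u v with R u v
  ... | true = count-singleton (col u v)
  ... | false = Σ-zero {W}

2*arcCount≤cost : ∀ C {N W} (R : Fin N → Fin N → Bool) → (∀ u → R u u ≡ false) →
                  (col : Fin N → Fin N → Fin W) → Admissible C R col →
                  2 * arcCount R ≤ suc C * cost R col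
2*arcCount≤cost C {N} {W} R R-irrefl col admissible = begin
    2 * arcCount R
  ≡⟨ cong (2 *_) (sym (arcCount-partition R col)) ⟩
    2 * Σ (λ ω → arcCount (B ω))
  ≡⟨ *-distribˡ-Σ 2 (λ ω → arcCount (B ω)) ⟩
    Σ (λ ω → 2 * arcCount (B ω))
  ≤⟨ Σ-mono (λ ω → 2*arcCount≤ (B ω) (λ u → cong (_∧ _) (R-irrefl u)) C (admissible ω)) ⟩
    Σ (λ ω → suc C * vertexCount R col ω)
  ≡⟨ sym (*-distribˡ-Σ (suc C) (vertexCount R col)) ⟩
    suc C * cost R col
  ∎
  where
  open ≤-Reasoning
  B : Fin W → Fin N → Fin N → Bool
  B = inB R col

proposition6 : (N : ℕ) → 2 ≤ N → ALowerBound 3 N (N * (N ∸ 1)) 4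
proposition6 N _ R isT W col admissible = begin
    N * (N ∸ 1)
  ≡⟨ arcCount-tournament R irrefl tournament ⟩
    2 * arcCount R
  ≤⟨ 2*arcCount≤cost 3 R irrefl col admissible ⟩
    4 * cost R col
  ∎
  where
  open IsRequestTournament isT
  open ≤-Reasoning
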